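{- Let $A$ and $B$ be density-1 reals. Then $A\cap B\equiv_g A\oplus B$, where $A\oplus B=\{2n:n\in A\}\cup\{2n+1:n\in B\}$.
   Context: Reals are subsets of $\mathbb{N}$; $n=\{0,\dots,n-1\}$; a real $A$ is density-1 if $\lim_{n\to\infty}|A\cap n|/n=1$. A partial oracle for a real $C$ is a set $(C)$ of triples $\langle n,x,l\rangle$ (coded as naturals, usable as a Turing oracle) such that $\langle n,0,l\rangle\in(C)$ implies $n\notin C$ and $\langle n,1,l\rangle\in(C)$ implies $n\in C$; $\mathrm{dom}((C))=\{n:\exists x,l\ \langle n,x,l\rangle\in(C)\}$. A generic oracle for $C$ is a partial oracle for $C$ with density-1 domain. $\varphi^X$ is a generic computation of $D$ if $\mathrm{dom}(\varphi^X)$ is density-1, $\varphi^X$ has values in $\{0,1\}$, and agrees with $D$ on its domain. $C\geq_g D$ if there is a single Turing functional $\varphi$ such that for every generic oracle $(C)$ for $C$, $\varphi^{(C)}$ is a generic computation of $D$; $C\equiv_g D$ means $C\geq_g D$ and $D\geq_g C$. -}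

module Defs where

open import Data.Nat using (ℕ; zero; suc; _+_; _*_; _≤_; _<_; _/_)
open import Data.Bool using (Bool; true; false; _∧_)
open import Data.Fin using (Fin)
open import Data.Vec using (Vec; []; _∷_; lookup)
open import Data.List using (List; length)
open import Data.List.Relation.Unary.All using (All)
open import Data.List.Relation.Unary.Unique.Propositional using (Unique)
open import Data.Product using (Σ; ∃; _×_; _,_)
open import Data.Sum using (_⊎_)
open import Relation.Binary.PropositionalEquality using (_≡_)

-- Reals: subsets of ℕ, given by their characteristic functions.

Real : Set
Real = ℕ → Bool

_∩_ : Real → Real → Real
(A ∩ B) n = A n ∧ B n

-- A ⊕ B = {2n : n ∈ A} ∪ {2n+1 : n ∈ B}
_⊕_ : Real → Real → Real
(A ⊕ B) zero = A zero
(A ⊕ B) (suc zero) = B zero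
(A ⊕ B) (suc (suc n)) = ((λ k → A (suc k)) ⊕ (λ k → B (suc k))) n

-- Density.  For a (possibly undecidable) predicate P on ℕ,
-- "|P ∩ n| ≥ m" is witnessed by m distinct elements below n satisfying P.

AtLeastBelow : (ℕ → Set) → ℕ → ℕ → Set
AtLeastBelow P n m =
  Σ (List ℕ) λ xs → length xs ≡ m × Unique xs × All (λ i → i < n) xs × All P xs

-- density-1:  lim |P ∩ n| / n = 1, i.e. for every k, eventually
-- |P ∩ n| / n ≥ 1 - 1/(k+1)   (the ratio is always ≤ 1).
Density1 : (ℕ → Set) → Set
Density1 P = ∀ (k : ℕ) → Σ ℕ λ N → ∀ (n : ℕ) → N ≤ n →
  Σ ℕ λ m → AtLeastBelow P n m × (k * n ≤ suc k * m)

Density1Real : Real → Set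
Density1Real A = Density1 (λ n → A n ≡ true)

-- Coding of triples ⟨n,x,l⟩ (Cantor pairing).

pair : ℕ → ℕ → ℕ
pair a b = ((a + b) * suc (a + b)) / 2 + b

triple : ℕ → ℕ → ℕ → ℕ
triple n x l = pair n (pair x l)

-- Turing functionals: oracle partial recursive functions.

data Code : ℕ → Set where
  zeroC : Code 0
  succC : Code 1
  projC : ∀ {n} → Fin n → Code n
  oracC : Code 1
  compC : ∀ {m n} → Code m → Vec (Code n) m → Code n
  primC : ∀ {n} → Code n → Code (suc (suc n)) → Code (suc n)
  muC   : ∀ {n} → Code (suc n) → Code n

bit : Bool → ℕ
bit true = 1
bit false = 0

mutual
  data Eval (X : ℕ → Bool) : ∀ {n} → Code n → Vec ℕ n → ℕ → Set where
    ev-zero : Eval X zeroC [] 0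
    ev-succ : ∀ x → Eval X succC (x ∷ []) (suc x)
    ev-proj : ∀ {n} (i : Fin n) xs → Eval X (projC i) xs (lookup xs i)
    ev-orac : ∀ x → Eval X oracC (x ∷ []) (bit (X x))
    ev-comp : ∀ {m n} {f : Code m} {gs : Vec (Code n) m} {xs ys y} →
              EvalVec X gs xs ys → Eval X f ys y → Eval X (compC f gs) xs y
    ev-prim0 : ∀ {n} {f : Code n} {g : Code (suc (suc n))} {xs y} →
               Eval X f xs y → Eval X (primC f g) (0 ∷ xs) y
    ev-primS : ∀ {n} {f : Code n} {g : Code (suc (suc n))} {k xs r y} →
               Eval X (primC f g) (k ∷ xs) r → Eval X g (k ∷ r ∷ xs) y →
               Eval X (primC f g) (suc k ∷ xs) y
    ev-mu : ∀ {n} {f : Code (suc n)} {xs y} →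
            Eval X f (y ∷ xs) 0 →
            (∀ i → i < y → Σ ℕ λ v → Eval X f (i ∷ xs) (suc v)) →
            Eval X (muC f) xs y

  data EvalVec (X : ℕ → Bool) {n : ℕ} : ∀ {m} → Vec (Code n) m → Vec ℕ n → Vec ℕ m → Set where
    evv-[] : ∀ {xs} → EvalVec X [] xs []
    evv-∷ : ∀ {m} {g : Code n} {gs : Vec (Code n) m} {xs y ys} →
            Eval X g xs y → EvalVec X gs xs ys → EvalVec X (g ∷ gs) xs (y ∷ ys)

TuringFunctional : Set
TuringFunctional = Code 1

_^_⟨_⟩⇓_ : TuringFunctional → (ℕ → Bool) → ℕ → ℕ → Set
φ ^ X ⟨ n ⟩⇓ y = Eval X φ (n ∷ []) y

record PartialOracle (C : Real) (O : ℕ → Bool) : Set where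
  field
    triples : ∀ m → O m ≡ true → Σ ℕ λ n → Σ ℕ λ x → Σ ℕ λ l → m ≡ triple n x l × x ≤ 1
    sound0  : ∀ n l → O (triple n 0 l) ≡ true → C n ≡ false
    sound1  : ∀ n l → O (triple n 1 l) ≡ true → C n ≡ true

dom : (ℕ → Bool) → ℕ → Set
dom O n = Σ ℕ λ x → Σ ℕ λ l → O (triple n x l) ≡ true

GenericOracle : Real → (ℕ → Bool) → Set
GenericOracle C O = PartialOracle C O × Density1 (dom O)

GenericComputation : TuringFunctional → (ℕ → Bool) → Real → Set
GenericComputation φ X D =
  Density1 (λ n → Σ ℕ λ y → φ ^ X ⟨ n ⟩⇓ y) ×
  (∀ n y → φ ^ X ⟨ n ⟩⇓ y → (y ≡ 0 × D n ≡ false) ⊎ (y ≡ 1 × D n ≡ true))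

_≥g_ : Real → Real → Set
C ≥g D = Σ TuringFunctional λ φ → ∀ (O : ℕ → Bool) → GenericOracle C O → GenericComputation φ O D

_≡g_ : Real → Real → Set
C ≡g D = (C ≥g D) × (D ≥g C)

-- Both reductions output the constant 1, but only on inputs whose membership
-- has been confirmed by the generic oracle.  For A ∩ B ≥g A ⊕ B the functional,
-- on input m, searches for a triple ⟨⌊m/2⌋,1,l⟩ in the oracle; finding one
-- shows ⌊m/2⌋ ∈ A ∩ B, hence m ∈ A ⊕ B.  It halts whenever ⌊m/2⌋ lies in
-- dom((A∩B)) ∩ A ∩ B, a density-one set.  For A ⊕ B ≥g A ∩ B the functional
-- searches for ⟨2n,1,l⟩ and ⟨2n+1,1,l⟩; it halts whenever 2n and 2n+1 lie in
-- dom((A⊕B)) and n ∈ A ∩ B, again a density-one set.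
module Submission where

open import Defs
open import Data.Nat using (ℕ; zero; suc; _+_; _*_; _≤_; _<_; _/_; _⊔_; _≡ᵇ_; z≤n; s≤s; ⌊_/2⌋)
open import Data.Nat.Properties
open import Data.Nat.DivMod using (m*n/n≡m)
open import Data.Bool using (Bool; true; false; _∧_; _∨_; not; if_then_else_; T)
open import Data.Unit using (tt)
open import Data.Fin using () renaming (zero to fz; suc to fs)
open import Data.Vec using (Vec; []; _∷_)
open import Data.List using (List; []; _∷_; length)
open import Data.List.Relation.Unary.All using (All; []; _∷_)
open import Data.List.Relation.Unary.AllPairs using ([]; _∷_)
open import Data.List.Relation.Unary.Unique.Propositional using (Unique)
open import Data.Sum using (inj₁; inj₂)
open import Data.Product using (Σ; _×_; _,_; proj₁; proj₂)
open import Function.Bundles using (_⇔_; mk⇔; Equivalence)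
open import Relation.Nullary using (contradiction)
open import Relation.Binary using (tri<; tri≈; tri>)
open import Relation.Binary.PropositionalEquality
open import Algebra.Properties.CommutativeSemigroup +-commutativeSemigroup using (interchange)
open import Data.Nat.Solver using (module +-*-Solver)
open +-*-Solver using (solve; _:+_; _:*_; _:=_; con)

∧-elim : ∀ {a b} → a ∧ b ≡ true → a ≡ true × b ≡ true
∧-elim {true} {true} _ = refl , refl

step-mono : (f : ℕ → ℕ) → (∀ n → f n ≤ f (suc n)) → ∀ {n m} → n ≤ m → f n ≤ f m
step-mono f step {m = zero} z≤n = ≤-refl
step-mono f step {n} {suc m} n≤1+m with m≤n⇒m<n∨m≡n n≤1+m
... | inj₁ (s≤s n≤m) = ≤-trans (step-mono f step n≤m) (step m)
... | inj₂ refl = ≤-refl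

-- (1) Evaluation is deterministic.  This is what lets us read off the
-- intermediate values inside a halting computation of our functionals.

mutual
  eval-det : ∀ {X n} {c : Code n} {xs y y'} → Eval X c xs y → Eval X c xs y' → y ≡ y'
  eval-det ev-zero ev-zero = refl
  eval-det (ev-succ x) (ev-succ .x) = refl
  eval-det (ev-proj i xs) (ev-proj .i .xs) = refl
  eval-det (ev-orac x) (ev-orac .x) = refl
  eval-det (ev-comp args₁ e₁) (ev-comp args₂ e₂) with evalVec-det args₁ args₂
  ... | refl = eval-det e₁ e₂
  eval-det (ev-prim0 e₁) (ev-prim0 e₂) = eval-det e₁ e₂
  eval-det (ev-primS r₁ e₁) (ev-primS r₂ e₂) with eval-det r₁ r₂
  ... | refl = eval-det e₁ e₂
  -- a μ-search halting at y and at y' < y would need f(y') to be both 0 and nonzero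
  eval-det {y = y} {y'} (ev-mu zero₁ below₁) (ev-mu zero₂ below₂) with <-cmp y y'
  ... | tri≈ _ y≡y' _ = y≡y'
  ... | tri< y<y' _ _ with eval-det zero₁ (proj₂ (below₂ y y<y'))
  ... | ()
  eval-det {y = y} {y'} (ev-mu zero₁ below₁) (ev-mu zero₂ below₂) | tri> _ _ y'<y
    with eval-det (proj₂ (below₁ y' y'<y)) zero₂
  ... | ()

  evalVec-det : ∀ {X n m} {gs : Vec (Code n) m} {xs ys ys'} →
                EvalVec X gs xs ys → EvalVec X gs xs ys' → ys ≡ ys'
  evalVec-det evv-[] evv-[] = refl
  evalVec-det (evv-∷ e₁ v₁) (evv-∷ e₂ v₂) = cong₂ _∷_ (eval-det e₁ e₂) (evalVec-det v₁ v₂)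

-- (2) The Cantor pairing is injective, so an oracle triple ⟨n,x,l⟩
-- determines n and x.

triangle : ℕ → ℕ
triangle zero    = zero
triangle (suc s) = triangle s + suc s

triangle*2 : ∀ s → triangle s * 2 ≡ s * suc s
triangle*2 zero    = refl
triangle*2 (suc s) = begin
    (triangle s + suc s) * 2          ≡⟨ *-distribʳ-+ 2 (triangle s) (suc s) ⟩
    triangle s * 2 + suc s * 2        ≡⟨ cong (_+ suc s * 2) (triangle*2 s) ⟩
    s * suc s + suc s * 2             ≡⟨ solve 1 (λ s → s :* (con 1 :+ s) :+ (con 1 :+ s) :* con 2
                                                  := (con 1 :+ s) :* (con 1 :+ (con 1 :+ s))) refl s ⟩
    suc s * suc (suc s)               ∎
  where open ≡-Reasoning

-- The division in the definition of `pair` is exact.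
pair≡triangle : ∀ a b → pair a b ≡ triangle (a + b) + b
pair≡triangle a b = cong (_+ b) (begin
    ((a + b) * suc (a + b)) / 2       ≡⟨ cong (_/ 2) (sym (triangle*2 (a + b))) ⟩
    (triangle (a + b) * 2) / 2        ≡⟨ m*n/n≡m (triangle (a + b)) 2 ⟩
    triangle (a + b)                  ∎)
  where open ≡-Reasoning

diagonal-below : ∀ {s b t d} → b ≤ s → s < t → triangle s + b < triangle t + d
diagonal-below {s} {b} {t} {d} b≤s s<t = begin-strict
    triangle s + b       ≤⟨ +-monoʳ-≤ (triangle s) b≤s ⟩
    triangle s + s       <⟨ +-monoʳ-< (triangle s) (n<1+n s) ⟩
    triangle (suc s)     ≤⟨ step-mono triangle (λ n → m≤m+n (triangle n) (suc n)) s<t ⟩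
    triangle t           ≤⟨ m≤m+n (triangle t) d ⟩
    triangle t + d       ∎
  where open ≤-Reasoning

diagonal-injective : ∀ a b c d → triangle (a + b) + b ≡ triangle (c + d) + d → a ≡ c × b ≡ d
diagonal-injective a b c d eq with <-cmp (a + b) (c + d)
... | tri< lt _ _ = contradiction eq (<⇒≢ (diagonal-below (m≤n+m b a) lt))
... | tri> _ _ gt = contradiction (sym eq) (<⇒≢ (diagonal-below (m≤n+m d c) gt))
... | tri≈ _ same-diagonal _ = a≡c , b≡d
  where
  b≡d : b ≡ d
  b≡d = +-cancelˡ-≡ (triangle (a + b)) b d (trans eq (cong (λ s → triangle s + d) (sym same-diagonal)))
  a≡c : a ≡ c
  a≡c = +-cancelʳ-≡ b a c (trans same-diagonal (cong (c +_) (sym b≡d)))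

pair-injective : ∀ a b c d → pair a b ≡ pair c d → a ≡ c × b ≡ d
pair-injective a b c d eq =
  diagonal-injective a b c d (trans (sym (pair≡triangle a b)) (trans eq (pair≡triangle c d)))

triple-injective : ∀ {n x l n' x' l'} → triple n x l ≡ triple n' x' l' → n ≡ n' × x ≡ x'
triple-injective {n} {x} {l} {n'} {x'} {l'} eq with pair-injective n _ n' _ eq
... | n≡n' , rest = n≡n' , proj₁ (pair-injective x l x' l' rest)

-- (3) Programs.  Arguments of a k-ary code are listed left to right; in
-- `primC f g` the step g receives (counter, previous value, parameters).

oneC : ∀ {n} → Code n
oneC = compC succC (compC zeroC [] ∷ [])

addC : Code 2
addC = primC (projC fz) (compC succC (projC (fs fz) ∷ []))

triangleC : Code 1
triangleC = primC zeroC (compC addC (projC (fs fz) ∷ compC succC (projC fz ∷ []) ∷ []))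

isZero : ℕ → ℕ
isZero zero    = 1
isZero (suc _) = 0

isZeroC : Code 1
isZeroC = primC oneC (compC zeroC [])

pairC : Code 2
pairC = compC addC (compC triangleC (addC ∷ []) ∷ projC (fs fz) ∷ [])

tripleC : Code 2
tripleC = compC pairC (projC (fs fz) ∷ compC pairC (oneC ∷ projC fz ∷ []) ∷ [])

rejectC : Code 2
rejectC = compC isZeroC (compC oracC (tripleC ∷ []) ∷ [])

-- p ↦ least l with ⟨p,1,l⟩ in the oracle: a search for a confirmation of p ∈ C
searchC : Code 1
searchC = muC rejectC

parityBit : ℕ → ℕ
parityBit zero    = 0
parityBit (suc k) = isZero (parityBit k)

parityC : Code 1
parityC = primC zeroC (compC isZeroC (projC (fs fz) ∷ []))

-- ⌊k/2⌋ computed by primitive recursion: ⌊(k+1)/2⌋ = ⌊k/2⌋ + parity k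
halfC : Code 1
halfC = primC zeroC (compC addC (projC (fs fz) ∷ compC parityC (projC fz ∷ []) ∷ []))

-- double n = 2n, by a recursion matching the clauses of _⊕_
double : ℕ → ℕ
double zero    = zero
double (suc n) = suc (suc (double n))

doubleC : Code 1
doubleC = primC zeroC (compC succC (compC succC (projC (fs fz) ∷ []) ∷ []))

parityBit-period : ∀ k → parityBit (suc (suc k)) ≡ parityBit k
parityBit-period zero    = refl
parityBit-period (suc k) = cong isZero (parityBit-period k)

half-step : ∀ k → ⌊ suc k /2⌋ ≡ ⌊ k /2⌋ + parityBit k
half-step zero          = refl
half-step (suc zero)    = refl
half-step (suc (suc k)) = cong suc (trans (half-step k) (cong (⌊ k /2⌋ +_) (sym (parityBit-period k))))

module _ (X : ℕ → Bool) where
  evOne : ∀ {n} (xs : Vec ℕ n) → Eval X oneC xs 1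
  evOne xs = ev-comp (evv-∷ (ev-comp evv-[] ev-zero) evv-[]) (ev-succ 0)

  evAdd : ∀ k m → Eval X addC (k ∷ m ∷ []) (k + m)
  evAdd zero    m = ev-prim0 (ev-proj fz (m ∷ []))
  evAdd (suc k) m = ev-primS (evAdd k m) (ev-comp (evv-∷ (ev-proj (fs fz) _) evv-[]) (ev-succ _))

  evTriangle : ∀ k → Eval X triangleC (k ∷ []) (triangle k)
  evTriangle zero    = ev-prim0 ev-zero
  evTriangle (suc k) =
    ev-primS (evTriangle k)
      (ev-comp (evv-∷ (ev-proj (fs fz) _) (evv-∷ (ev-comp (evv-∷ (ev-proj fz _) evv-[]) (ev-succ k)) evv-[]))
               (evAdd (triangle k) (suc k)))

  evIsZero : ∀ k → Eval X isZeroC (k ∷ []) (isZero k)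
  evIsZero zero    = ev-prim0 (evOne [])
  evIsZero (suc k) = ev-primS (evIsZero k) (ev-comp evv-[] ev-zero)

  evPair : ∀ a b → Eval X pairC (a ∷ b ∷ []) (pair a b)
  evPair a b =
    subst (Eval X pairC (a ∷ b ∷ [])) (sym (pair≡triangle a b))
      (ev-comp (evv-∷ (ev-comp (evv-∷ (evAdd a b) evv-[]) (evTriangle (a + b)))
                      (evv-∷ (ev-proj (fs fz) _) evv-[]))
               (evAdd _ _))

  evTriple : ∀ l p → Eval X tripleC (l ∷ p ∷ []) (triple p 1 l)
  evTriple l p =
    ev-comp (evv-∷ (ev-proj (fs fz) _)
                   (evv-∷ (ev-comp (evv-∷ (evOne _) (evv-∷ (ev-proj fz _) evv-[])) (evPair 1 l)) evv-[]))
            (evPair p _)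

  evReject : ∀ {l p b} → X (triple p 1 l) ≡ b → Eval X rejectC (l ∷ p ∷ []) (isZero (bit b))
  evReject {l} {p} refl = ev-comp (evv-∷ (ev-comp (evv-∷ (evTriple l p) evv-[]) (ev-orac _)) evv-[]) (evIsZero _)

  evParity : ∀ k → Eval X parityC (k ∷ []) (parityBit k)
  evParity zero    = ev-prim0 ev-zero
  evParity (suc k) = ev-primS (evParity k) (ev-comp (evv-∷ (ev-proj (fs fz) _) evv-[]) (evIsZero _))

  evHalf : ∀ k → Eval X halfC (k ∷ []) ⌊ k /2⌋
  evHalf zero    = ev-prim0 ev-zero
  evHalf (suc k) =
    subst (Eval X halfC (suc k ∷ [])) (sym (half-step k))
      (ev-primS (evHalf k)
        (ev-comp (evv-∷ (ev-proj (fs fz) _) (evv-∷ (ev-comp (evv-∷ (ev-proj fz _) evv-[]) (evParity k)) evv-[]))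
                 (evAdd _ _)))

  evDouble : ∀ k → Eval X doubleC (k ∷ []) (double k)
  evDouble zero    = ev-prim0 ev-zero
  evDouble (suc k) =
    ev-primS (evDouble k) (ev-comp (evv-∷ (ev-comp (evv-∷ (ev-proj (fs fz) _) evv-[]) (ev-succ _)) evv-[]) (ev-succ _))

  search-sound : ∀ {p y} → Eval X searchC (p ∷ []) y → X (triple p 1 y) ≡ true
  search-sound {p} {y} (ev-mu hit _) = rejected (eval-det hit (evReject {l = y} {p} refl))
    where
    rejected : ∀ {b} → 0 ≡ isZero (bit b) → b ≡ true
    rejected {true} _ = refl

  search-complete : ∀ p l → X (triple p 1 l) ≡ true → Σ ℕ λ y → Eval X searchC (p ∷ []) y
  search-complete p l hit = searchFrom 0 l (λ _ ()) (subst Hit (sym (+-identityʳ l)) hit)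
    where
    Hit : ℕ → Set
    Hit z = X (triple p 1 z) ≡ true
    -- invariant: no confirmation below j, and one at d + j
    searchFrom : ∀ j d → (∀ i → i < j → X (triple p 1 i) ≡ false) → Hit (d + j) →
                 Σ ℕ λ y → Eval X searchC (p ∷ []) y
    searchFrom j d none hit with X (triple p 1 j) in hitⱼ
    ... | true = j , ev-mu (evReject hitⱼ) (λ i i<j → 0 , evReject (none i i<j))
    searchFrom j zero    none hit | false = contradiction (trans (sym hitⱼ) hit) λ ()
    searchFrom j (suc d) none hit | false =
      searchFrom (suc j) d none′ (subst Hit (sym (+-suc d j)) hit)
      where
      none′ : ∀ i → i < suc j → X (triple p 1 i) ≡ false
      none′ i (s≤s i≤j) with m≤n⇒m<n∨m≡n i≤j
      ... | inj₁ i<j = none i i<j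
      ... | inj₂ refl = hitⱼ

search-certifies : ∀ {C O p y} → PartialOracle C O → Eval O searchC (p ∷ []) y → C p ≡ true
search-certifies {p = p} {y} po e = PartialOracle.sound1 po p y (search-sound _ e)

search-halts : ∀ {C O} → PartialOracle C O → ∀ n → dom O n → C n ≡ true →
               Σ ℕ λ y → Eval O searchC (n ∷ []) y
search-halts {O = O} po n (x , l , inO) n∈C with PartialOracle.triples po (triple n x l) inO
... | n' , x' , l' , eq , x'≤1 with triple-injective {n} {x} {l} {n'} {x'} {l'} eq
... | refl , refl with x | x'≤1
... | zero     | _ = contradiction (trans (sym n∈C) (PartialOracle.sound0 po n l inO)) λ ()
... | suc zero | _ = search-complete O n l inO
... | suc (suc _) | s≤s ()

-- (4) Density one in counting form.  A Boolean selector f ⊆ P witnesses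
-- that P is large below n when (k+1)·#{i < n : ¬ f i} ≤ n.

count : (ℕ → Bool) → ℕ → ℕ
count f zero    = 0
count f (suc n) = bit (f n) + count f n

missing : (ℕ → Bool) → ℕ → ℕ
missing f = count (λ i → not (f i))

_⊆ᵇ_ : (ℕ → Bool) → (ℕ → Set) → Set
f ⊆ᵇ P = ∀ i → f i ≡ true → P i

CountDensity1 : (ℕ → Set) → Set
CountDensity1 P = ∀ (k : ℕ) → Σ ℕ λ N → ∀ (n : ℕ) → N ≤ n →
  Σ (ℕ → Bool) λ f → f ⊆ᵇ P × (suc k * missing f n ≤ n)

count-split : ∀ f n → count f n + missing f n ≡ n
count-split f zero    = refl
count-split f (suc n) =
  trans (interchange (bit (f n)) (count f n) (bit (not (f n))) (missing f n))
        (cong₂ _+_ (bit+bit-not (f n)) (count-split f n))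
  where
  bit+bit-not : ∀ b → bit b + bit (not b) ≡ 1
  bit+bit-not true  = refl
  bit+bit-not false = refl

count-subadditive : ∀ h f g → (∀ i → bit (h i) ≤ bit (f i) + bit (g i)) →
                    ∀ n → count h n ≤ count f n + count g n
count-subadditive h f g pointwise zero    = z≤n
count-subadditive h f g pointwise (suc n) =
  ≤-trans (+-mono-≤ (pointwise n) (count-subadditive h f g pointwise n))
          (≤-reflexive (interchange (bit (f n)) (bit (g n)) (count f n) (count g n)))

bit-not-∧ : ∀ a b → bit (not (a ∧ b)) ≤ bit (not a) + bit (not b)
bit-not-∧ true  true  = z≤n
bit-not-∧ true  false = ≤-refl
bit-not-∧ false b     = s≤s z≤n

missing-∧ : ∀ f g n → missing (λ i → f i ∧ g i) n ≤ missing f n + missing g n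
missing-∧ f g = count-subadditive _ _ _ (λ i → bit-not-∧ (f i) (g i))

missing-pairs : ∀ f n → missing (λ i → f (double i) ∧ f (suc (double i))) n ≤ missing f (double n)
missing-pairs f zero    = z≤n
missing-pairs f (suc n) = begin
    bit (not (f even ∧ f odd)) + missing g n     ≤⟨ +-mono-≤ (bit-not-∧ (f even) (f odd)) (missing-pairs f n) ⟩
    (bit (not (f even)) + bit (not (f odd))) + missing f (double n)
                                                 ≡⟨ cong (_+ missing f (double n)) (+-comm (bit (not (f even))) _) ⟩
    (bit (not (f odd)) + bit (not (f even))) + missing f (double n)
                                                 ≡⟨ +-assoc (bit (not (f odd))) _ _ ⟩
    missing f (double (suc n))                   ∎
  where
  open ≤-Reasoning
  even = double n
  odd  = suc (double n)
  g = λ i → f (double i) ∧ f (suc (double i))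

half-double : ∀ n → ⌊ double n /2⌋ ≡ n × ⌊ suc (double n) /2⌋ ≡ n
half-double zero    = refl , refl
half-double (suc n) = cong suc (proj₁ (half-double n)) , cong suc (proj₂ (half-double n))

count-half : ∀ f n → count (λ m → f ⌊ m /2⌋) (double n) ≡ count f n + count f n
count-half f zero    = refl
count-half f (suc n) rewrite proj₁ (half-double n) | proj₂ (half-double n) | count-half f n =
  solve 2 (λ a c → a :+ (a :+ (c :+ c)) := (a :+ c) :+ (a :+ c)) refl (bit (f n)) (count f n)

double≡+ : ∀ n → double n ≡ n + n
double≡+ zero    = refl
double≡+ (suc n) = cong suc (trans (cong suc (double≡+ n)) (sym (+-suc n n)))

n≤double : ∀ n → n ≤ double n
n≤double n = subst (n ≤_) (sym (double≡+ n)) (m≤m+n n n)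

count-mono : ∀ f {n m} → n ≤ m → count f n ≤ count f m
count-mono f = step-mono (count f) (λ n → m≤n+m (count f n) (bit (f n)))

-- Arithmetic: with n split as c + b, the ratio bound k·n ≤ (k+1)·c and the
-- missing bound (k+1)·b ≤ n both say  k·b ≤ c.
ratio⇔ : ∀ k c b → (k * (c + b) ≤ suc k * c) ⇔ (k * b ≤ c)
ratio⇔ k c b = mk⇔
  (λ le → +-cancelˡ-≤ (k * c) (k * b) c
            (subst₂ _≤_ (*-distribˡ-+ k c b) (+-comm c (k * c)) le))
  (λ kb≤c → subst₂ _≤_ (sym (*-distribˡ-+ k c b)) (+-comm (k * c) c) (+-monoʳ-≤ (k * c) kb≤c))

missing⇔ : ∀ k c b → (suc k * b ≤ c + b) ⇔ (k * b ≤ c)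
missing⇔ k c b = mk⇔
  (λ le → +-cancelˡ-≤ b (k * b) c (subst (b + k * b ≤_) (+-comm c b) le))
  (λ kb≤c → subst (b + k * b ≤_) (+-comm b c) (+-monoʳ-≤ b kb≤c))

+-self-cancel-≤ : ∀ {x n} → x + x ≤ n + n → x ≤ n
+-self-cancel-≤ le = ≮⇒≥ (λ n<x → <⇒≱ (+-mono-< n<x n<x) le)

split-budget : ∀ s b₁ b₂ n → (s + s) * b₁ ≤ n → (s + s) * b₂ ≤ n → s * (b₁ + b₂) ≤ n
split-budget s b₁ b₂ n le₁ le₂ = +-self-cancel-≤ (subst (_≤ n + n) eq (+-mono-≤ le₁ le₂))
  where
  eq : (s + s) * b₁ + (s + s) * b₂ ≡ s * (b₁ + b₂) + s * (b₁ + b₂)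
  eq = solve 3 (λ s b₁ b₂ → (s :+ s) :* b₁ :+ (s :+ s) :* b₂ := s :* (b₁ :+ b₂) :+ s :* (b₁ :+ b₂)) refl s b₁ b₂

halve-budget : ∀ s b n → (s + s) * b ≤ n + n → s * b ≤ n
halve-budget s b n le = +-self-cancel-≤ (subst (_≤ n + n) (*-distribʳ-+ b s s) le)

selected : (ℕ → Bool) → ℕ → List ℕ
selected f zero    = []
selected f (suc n) = if f n then n ∷ selected f n else selected f n

All-<-suc : ∀ {n xs} → All (_< n) xs → All (_< suc n) xs
All-<-suc [] = []
All-<-suc (p ∷ ps) = m≤n⇒m≤1+n p ∷ All-<-suc ps

All-<⇒≢ : ∀ {n xs} → All (_< n) xs → All (n ≢_) xs
All-<⇒≢ [] = []
All-<⇒≢ (p ∷ ps) = (λ eq → <-irrefl (sym eq) p) ∷ All-<⇒≢ ps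

selected-witness : ∀ P f → f ⊆ᵇ P → ∀ n → AtLeastBelow P n (count f n)
selected-witness P f f⊆P zero = [] , refl , [] , [] , []
selected-witness P f f⊆P (suc n) with f n in fn | selected-witness P f f⊆P n
... | true  | xs , len , u , below , inP =
  n ∷ xs , cong suc len , All-<⇒≢ below ∷ u , n<1+n n ∷ All-<-suc below , f⊆P n fn ∷ inP
... | false | xs , len , u , below , inP = xs , len , u , All-<-suc below , inP

_∈ᵇ_ : ℕ → List ℕ → Bool
i ∈ᵇ []       = false
i ∈ᵇ (x ∷ xs) = (i ≡ᵇ x) ∨ (i ∈ᵇ xs)

≡ᵇ-true : ∀ {i x} → (i ≡ᵇ x) ≡ true → i ≡ x
≡ᵇ-true {i} {x} e = ≡ᵇ⇒≡ i x (subst T (sym e) tt)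

∈ᵇ-All : ∀ {P : ℕ → Set} {xs} → All P xs → (λ i → i ∈ᵇ xs) ⊆ᵇ P
∈ᵇ-All {P} {x ∷ xs} (px ∷ pxs) i i∈ with i ≡ᵇ x in i≡ᵇx
... | true  = subst P (sym (≡ᵇ-true i≡ᵇx)) px
... | false = ∈ᵇ-All pxs i i∈

∉ᵇ : ∀ {x xs} → All (x ≢_) xs → x ∈ᵇ xs ≡ false
∉ᵇ [] = refl
∉ᵇ {x} (_∷_ {x = y} x≢y rest) with x ≡ᵇ y in x≡ᵇy
... | true  = contradiction (≡ᵇ-true x≡ᵇy) x≢y
... | false = ∉ᵇ rest

count-insert-above : ∀ f x n → n ≤ x → count (λ i → (i ≡ᵇ x) ∨ f i) n ≡ count f n
count-insert-above f x zero    _   = refl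
count-insert-above f x (suc n) n<x with n ≡ᵇ x in n≡ᵇx
... | true  = contradiction (≡ᵇ-true n≡ᵇx) (<⇒≢ n<x)
... | false = cong (bit (f n) +_) (count-insert-above f x n (<⇒≤ n<x))

count-insert : ∀ f x → f x ≡ false → ∀ n → x < n → count (λ i → (i ≡ᵇ x) ∨ f i) n ≡ suc (count f n)
count-insert f x fx (suc n) (s≤s x≤n) with n ≡ᵇ x in n≡ᵇx
... | true  = cong suc (begin
      count (λ i → (i ≡ᵇ x) ∨ f i) n   ≡⟨ count-insert-above f x n (≤-reflexive n≡x) ⟩
      count f n                        ≡⟨ cong (λ b → bit b + count f n) (sym (trans (cong f n≡x) fx)) ⟩
      bit (f n) + count f n            ∎)
  where
  open ≡-Reasoning
  n≡x = ≡ᵇ-true n≡ᵇx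
... | false = trans (cong (bit (f n) +_) (count-insert f x fx n (≤∧≢⇒< x≤n x≢n)))
                    (+-suc (bit (f n)) (count f n))
  where
  x≢n : x ≢ n
  x≢n refl = subst T n≡ᵇx (≡⇒≡ᵇ n n refl)

unique-count : ∀ n xs → Unique xs → All (_< n) xs → length xs ≤ count (λ i → i ∈ᵇ xs) n
unique-count n []       _               _             = z≤n
unique-count n (x ∷ xs) (x∉xs ∷ unique) (x<n ∷ xs<n) =
  ≤-trans (s≤s (unique-count n xs unique xs<n))
          (≤-reflexive (sym (count-insert (λ i → i ∈ᵇ xs) x (∉ᵇ x∉xs) n x<n)))

density1⇒count : ∀ P → Density1 P → CountDensity1 P
density1⇒count P D k with D k
... | N , large = N , λ n N≤n → fromList n (large n N≤n)
  where
  fromList : ∀ n → (Σ ℕ λ m → AtLeastBelow P n m × (k * n ≤ suc k * m)) →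
             Σ (ℕ → Bool) λ f → f ⊆ᵇ P × (suc k * missing f n ≤ n)
  fromList n (m , (xs , len , unique , below , inP) , ratio) =
    f , ∈ᵇ-All inP ,
    subst (suc k * missing f n ≤_) (count-split f n)
      (Equivalence.from (missing⇔ k c b) (Equivalence.to (ratio⇔ k c b)
        (≤-trans (subst (λ z → k * z ≤ suc k * m) (sym (count-split f n)) ratio)
                 (*-monoʳ-≤ (suc k) (subst (_≤ c) len (unique-count n xs unique below))))))
    where
    f = λ i → i ∈ᵇ xs
    c = count f n
    b = missing f n

count⇒density1 : ∀ P → CountDensity1 P → Density1 P
count⇒density1 P D k with D k
... | N , large = N , λ n N≤n → toList n (large n N≤n)
  where
  toList : ∀ n → (Σ (ℕ → Bool) λ f → f ⊆ᵇ P × (suc k * missing f n ≤ n)) →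
           Σ ℕ λ m → AtLeastBelow P n m × (k * n ≤ suc k * m)
  toList n (f , f⊆P , few) =
    count f n , selected-witness P f f⊆P n ,
    subst (λ z → k * z ≤ suc k * count f n) (count-split f n)
      (Equivalence.from (ratio⇔ k c b) (Equivalence.to (missing⇔ k c b)
        (subst (suc k * b ≤_) (sym (count-split f n)) few)))
    where
    c = count f n
    b = missing f n

count-density1-mono : ∀ {P Q : ℕ → Set} → (∀ i → P i → Q i) → CountDensity1 P → CountDensity1 Q
count-density1-mono P⊆Q D k with D k
... | N , large = N , λ n N≤n → let (f , f⊆P , few) = large n N≤n in f , (λ i fi → P⊆Q i (f⊆P i fi)) , few

-- The bound for accuracy k is obtained from the bounds for accuracy 2k+1,
-- whose factor suc (k + suc k) is definitionally suc k + suc k.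
count-density1-∩ : ∀ {P Q : ℕ → Set} → CountDensity1 P → CountDensity1 Q → CountDensity1 (λ i → P i × Q i)
count-density1-∩ DP DQ k with DP (k + suc k) | DQ (k + suc k)
... | N₁ , largeP | N₂ , largeQ = N₁ ⊔ N₂ , λ n N≤n →
  let (f , f⊆P , fewP) = largeP n (≤-trans (m≤m⊔n N₁ N₂) N≤n)
      (g , g⊆Q , fewQ) = largeQ n (≤-trans (m≤n⊔m N₁ N₂) N≤n)
  in (λ i → f i ∧ g i) ,
     (λ i fgi → let (fi , gi) = ∧-elim fgi in f⊆P i fi , g⊆Q i gi) ,
     ≤-trans (*-monoʳ-≤ (suc k) (missing-∧ f g n)) (split-budget (suc k) _ _ n fewP fewQ)

count-density1-pairs : ∀ {P : ℕ → Set} → CountDensity1 P → CountDensity1 (λ i → P (double i) × P (suc (double i)))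
count-density1-pairs {P} D k with D (k + suc k)
... | N , large = N , λ n N≤n →
  let (f , f⊆P , few) = large (double n) (≤-trans N≤n (n≤double n))
  in (λ i → f (double i) ∧ f (suc (double i))) ,
     (λ i fi → let (f2i , f2i+1) = ∧-elim fi in f⊆P (double i) f2i , f⊆P (suc (double i)) f2i+1) ,
     ≤-trans (*-monoʳ-≤ (suc k) (missing-pairs f n))
             (halve-budget (suc k) _ n (subst (suc (k + suc k) * missing f (double n) ≤_) (double≡+ n) few))

count-density1-half : ∀ {P : ℕ → Set} → CountDensity1 P → CountDensity1 (λ m → P ⌊ m /2⌋)
count-density1-half {P} D k with D (k + suc k)
... | N , large = N , λ n N≤n →
  let (f , f⊆P , few) = large n N≤n
  in (λ m → f ⌊ m /2⌋) , (λ m → f⊆P ⌊ m /2⌋) ,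
     ≤-trans (*-monoʳ-≤ (suc k) (≤-trans (count-mono _ (n≤double n)) (≤-reflexive (count-half (λ i → not (f i)) n))))
             (subst (_≤ n) (trans (*-distribʳ-+ (missing f n) (suc k) (suc k))
                                   (sym (*-distribˡ-+ (suc k) (missing f n) (missing f n)))) few)

Halts : TuringFunctional → (ℕ → Bool) → ℕ → Set
Halts φ X n = Σ ℕ λ y → φ ^ X ⟨ n ⟩⇓ y

confirming⇒generic : ∀ {φ X D} → CountDensity1 (Halts φ X) →
                     (∀ n y → φ ^ X ⟨ n ⟩⇓ y → y ≡ 1 × D n ≡ true) → GenericComputation φ X D
confirming⇒generic halts confirms = count⇒density1 _ halts , λ n y run → inj₂ (confirms n y run)

join-even : ∀ A B n → (A ⊕ B) (double n) ≡ A n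
join-even A B zero    = refl
join-even A B (suc n) = join-even (λ k → A (suc k)) (λ k → B (suc k)) n

join-odd : ∀ A B n → (A ⊕ B) (suc (double n)) ≡ B n
join-odd A B zero    = refl
join-odd A B (suc n) = join-odd (λ k → A (suc k)) (λ k → B (suc k)) n

join-half : ∀ A B m → A ⌊ m /2⌋ ≡ true → B ⌊ m /2⌋ ≡ true → (A ⊕ B) m ≡ true
join-half A B zero          a b = a
join-half A B (suc zero)    a b = b
join-half A B (suc (suc m)) a b = join-half (λ k → A (suc k)) (λ k → B (suc k)) m a b

-- On input m: confirm ⌊m/2⌋ ∈ A ∩ B, then answer 1.
joinFromMeet : TuringFunctional
joinFromMeet = compC oneC (compC searchC (halfC ∷ []) ∷ [])

meet≥join : (A B : Real) → Density1Real A → Density1Real B → (A ∩ B) ≥g (A ⊕ B)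
meet≥join A B DA DB = joinFromMeet , λ O (po , domDense) → confirming⇒generic (halts O po domDense) (confirms O po)
  where
  confirms : ∀ O → PartialOracle (A ∩ B) O → ∀ m y → joinFromMeet ^ O ⟨ m ⟩⇓ y → y ≡ 1 × (A ⊕ B) m ≡ true
  confirms O po m y (ev-comp (evv-∷ (ev-comp (evv-∷ halving evv-[]) search) evv-[]) answer)
    with eval-det halving (evHalf O m)
  ... | refl = let (a , b) = ∧-elim (search-certifies po search)
               in eval-det answer (evOne O _) , join-half A B m a b

  halts : ∀ O → PartialOracle (A ∩ B) O → Density1 (dom O) → CountDensity1 (Halts joinFromMeet O)
  halts O po domDense =
    count-density1-mono run
      (count-density1-half (count-density1-∩ (density1⇒count _ domDense)
                                              (count-density1-∩ (density1⇒count _ DA) (density1⇒count _ DB))))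
    where
    run : ∀ m → dom O ⌊ m /2⌋ × (A ⌊ m /2⌋ ≡ true × B ⌊ m /2⌋ ≡ true) → Halts joinFromMeet O m
    run m (d , a , b) =
      let (y , search) = search-halts po ⌊ m /2⌋ d (cong₂ _∧_ a b)
      in 1 , ev-comp (evv-∷ (ev-comp (evv-∷ (evHalf O m) evv-[]) search) evv-[]) (evOne O _)

-- On input n: confirm 2n ∈ A ⊕ B and 2n+1 ∈ A ⊕ B, then answer 1.
meetFromJoin : TuringFunctional
meetFromJoin = compC oneC (compC searchC (doubleC ∷ []) ∷ compC searchC (compC succC (doubleC ∷ []) ∷ []) ∷ [])

join≥meet : (A B : Real) → Density1Real A → Density1Real B → (A ⊕ B) ≥g (A ∩ B)
join≥meet A B DA DB = meetFromJoin , λ O (po , domDense) → confirming⇒generic (halts O po domDense) (confirms O po)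
  where
  confirms : ∀ O → PartialOracle (A ⊕ B) O → ∀ n y → meetFromJoin ^ O ⟨ n ⟩⇓ y → y ≡ 1 × (A ∩ B) n ≡ true
  confirms O po n y
    (ev-comp (evv-∷ (ev-comp (evv-∷ doubling₁ evv-[]) search₁)
             (evv-∷ (ev-comp (evv-∷ (ev-comp (evv-∷ doubling₂ evv-[]) (ev-succ _)) evv-[]) search₂) evv-[]))
             answer)
    with eval-det doubling₁ (evDouble O n) | eval-det doubling₂ (evDouble O n)
  ... | refl | refl =
    eval-det answer (evOne O _) ,
    cong₂ _∧_ (trans (sym (join-even A B n)) (search-certifies po search₁))
              (trans (sym (join-odd A B n)) (search-certifies po search₂))

  halts : ∀ O → PartialOracle (A ⊕ B) O → Density1 (dom O) → CountDensity1 (Halts meetFromJoin O)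
  halts O po domDense =
    count-density1-mono run
      (count-density1-∩ (count-density1-pairs (density1⇒count _ domDense))
                        (count-density1-∩ (density1⇒count _ DA) (density1⇒count _ DB)))
    where
    run : ∀ n → (dom O (double n) × dom O (suc (double n))) × (A n ≡ true × B n ≡ true) → Halts meetFromJoin O n
    run n ((d₁ , d₂) , a , b) =
      let (_ , search₁) = search-halts po (double n) d₁ (trans (join-even A B n) a)
          (_ , search₂) = search-halts po (suc (double n)) d₂ (trans (join-odd A B n) b)
      in 1 , ev-comp (evv-∷ (ev-comp (evv-∷ (evDouble O n) evv-[]) search₁)
                     (evv-∷ (ev-comp (evv-∷ (ev-comp (evv-∷ (evDouble O n) evv-[]) (ev-succ _)) evv-[]) search₂) evv-[]))
                     (evOne O _)

mainTheorem16 : (A B : Real) → Density1Real A → Density1Real B → (A ∩ B) ≡g (A ⊕ B)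
mainTheorem16 A B DA DB = meet≥join A B DA DB , join≥meet A B DA DB
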